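{- Suppose $G$ is a graph with $\chi_{DP}(G)\ge 2$ and $V(G)=\{v_1,\ldots,v_n\}$. Let $\mathcal{F}\subseteq\mathbb{F}_3[x_1,\ldots,x_n]$ be the set of polynomials $$\mathcal{F}=\Big\{\prod_{v_iv_j\in E(G),\, j>i}(x_i+b_{i,j}x_j)\;:\;\text{each } b_{i,j}\in\{ -1,1\}\Big\}.$$ If for each $f\in\mathcal{F}$ there exists $(t_1,\ldots,t_n)\in\{0,1,2\}^n$ such that the coefficient of $\prod_{i=1}^n x_i^{t_i}$ in the expansion of $f$ is nonzero, then $\chi_{DP}(G)\le 3$.
   Context: All graphs are finite and simple; $\mathbb{F}_3$ is the field with three elements. A cover of a graph $G$ is a pair $\mathcal{H}=(L,H)$ where $H$ is a graph and $L:V(G)\to\mathcal{P}(V(H))$ satisfies: (1) $\{L(u):u\in V(G)\}$ is a partition of $V(H)$; (2) each $H[L(u)]$ is complete; (3) if $E_H(L(u),L(v))\neq\emptyset$ then $u=v$ or $uv\in E(G)$; (4) if $uv\in E(G)$ then $E_H(L(u),L(v))$ is a matching (possibly empty). An $\mathcal{H}$-coloring of $G$ is an independent set in $H$ of size $|V(G)|$. The cover is $m$-fold if $|L(u)|=m$ for all $u$. The DP-chromatic number $\chi_{DP}(G)$ is the least $m\in\mathbb{N}$ such that $G$ has an $\mathcal{H}$-coloring for every $m$-fold cover $\mathcal{H}$ of $G$. -}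

module Defs where

open import Data.Nat using (ℕ; zero; suc; _+_; _*_; _<_; _<ᵇ_)
open import Data.Nat.DivMod using (_mod_)
open import Data.Bool using (Bool; true; false; if_then_else_; _∧_)
open import Data.Fin using (Fin; toℕ; _≟_)
import Data.Fin as F
open import Data.Fin.Subset using (Subset; _∈_; ∣_∣)
open import Data.Vec using (Vec; tabulate; replicate; zipWith)
import Data.Vec.Properties as VP
import Data.Nat as N
open import Data.List using (List; []; _∷_; map; concatMap; foldr; allFin)
open import Data.Product using (Σ; _×_; _,_; ∃)
open import Data.Sum using (_⊎_)
open import Relation.Binary.PropositionalEquality using (_≡_; _≢_)
open import Relation.Nullary using (¬_; yes; no)
open import Level using (0ℓ)

-- Finite simple graphs on the vertex set Fin n  (v_{i+1} ↔ i : Fin n)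

record SimpleGraph (n : ℕ) : Set where
  field
    E    : Fin n → Fin n → Bool
    sym  : ∀ i j → E i j ≡ E j i
    irr  : ∀ i → E i i ≡ false
open SimpleGraph public

record Cover {n : ℕ} (G : SimpleGraph n) : Set where
  field
    N  : ℕ
    H  : SimpleGraph N
    L  : Fin n → Subset N
    part-cover    : ∀ (h : Fin N) → ∃ λ u → h ∈ L u
    part-disjoint : ∀ (h : Fin N) (u v : Fin n) → h ∈ L u → h ∈ L v → u ≡ v
    complete : ∀ (u : Fin n) (h h' : Fin N) → h ∈ L u → h' ∈ L u → h ≢ h' →
               E H h h' ≡ true
    edges-ok : ∀ (u v : Fin n) (h h' : Fin N) → h ∈ L u → h' ∈ L v →
               E H h h' ≡ true → (u ≡ v) ⊎ (E G u v ≡ true)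
    -- (4) for uv ∈ E(G), E_H(L u, L v) is a matching
    --     (quantified over both orders (u,v),(v,u) since E G is symmetric)
    matching : ∀ (u v : Fin n) → E G u v ≡ true →
               ∀ (h h₁ h₂ : Fin N) → h ∈ L u → h₁ ∈ L v → h₂ ∈ L v →
               E H h h₁ ≡ true → E H h h₂ ≡ true → h₁ ≡ h₂
open Cover public

IsFold : ∀ {n} {G : SimpleGraph n} → Cover G → ℕ → Set
IsFold {n} C m = ∀ (u : Fin n) → ∣ L C u ∣ ≡ m

HasColoring : ∀ {n} {G : SimpleGraph n} → Cover G → Set
HasColoring {n} C =
  Σ (Subset (N C)) λ I →
    (∀ h h' → h ∈ I → h' ∈ I → E (H C) h h' ≡ false) × (∣ I ∣ ≡ n)

DPColorable : ∀ {n} → SimpleGraph n → ℕ → Set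
DPColorable G m = ∀ (C : Cover G) → IsFold C m → HasColoring C

-- χ_DP(G) = least m with DPColorable G m.
-- χ_DP(G) ≤ k  iff some m ≤ k has the property;
-- χ_DP(G) ≥ k  iff no m < k has the property.
χDP≤ : ∀ {n} → SimpleGraph n → ℕ → Set
χDP≤ G k = ∃ λ m → m N.≤ k × DPColorable G m

χDP≥ : ∀ {n} → SimpleGraph n → ℕ → Set
χDP≥ G k = ∀ m → m < k → ¬ DPColorable G m

F3 : Set
F3 = Fin 3

_+₃_ : F3 → F3 → F3
a +₃ b = (toℕ a + toℕ b) mod 3

_*₃_ : F3 → F3 → F3
a *₃ b = (toℕ a * toℕ b) mod 3

0₃ 1₃ -1₃ : F3
0₃ = F.zero
1₃ = F.suc F.zero
-1₃ = F.suc (F.suc F.zero)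

-- Polynomials in F₃[x₁,…,xₙ] as formal sums of terms c·x^e,
-- e : Vec ℕ n the exponent vector.

Poly : ℕ → Set
Poly n = List (Vec ℕ n × F3)

onePoly : ∀ {n} → Poly n
onePoly {n} = (replicate n 0 , 1₃) ∷ []

_*P_ : ∀ {n} → Poly n → Poly n → Poly n
p *P q = concatMap (λ { (e , c) → map (λ { (e' , c') → (zipWith _+_ e e' , c *₃ c') }) q }) p

prodP : ∀ {n} → List (Poly n) → Poly n
prodP = foldr _*P_ onePoly

coeff : ∀ {n} → Poly n → Vec ℕ n → F3
coeff p t = foldr (λ { (e , c) acc → if does (VP.≡-dec N._≟_ e t) then c +₃ acc else acc }) 0₃ p
  where open Relation.Nullary using (does)

unit : ∀ {n} → Fin n → Vec ℕ n
unit i = tabulate (λ k → if does (k ≟ i) then 1 else 0)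
  where open Relation.Nullary using (does)

linForm : ∀ {n} → Fin n → F3 → Fin n → Poly n
linForm i b j = (unit i , 1₃) ∷ (unit j , b) ∷ []

sign : Bool → F3
sign true  = 1₃
sign false = -1₃

edgesLt : ∀ {n} → SimpleGraph n → List (Fin n × Fin n)
edgesLt {n} G =
  concatMap (λ i → concatMap (λ j →
     if E G i j ∧ (toℕ i <ᵇ toℕ j) then (i , j) ∷ [] else []) (allFin n)) (allFin n)

-- the member of 𝓕 determined by the choice b_{i,j} = sign (b i j)
fPoly : ∀ {n} → SimpleGraph n → (Fin n → Fin n → Bool) → Poly n
fPoly G b = prodP (map (λ { (i , j) → linForm i (sign (b i j)) j }) (edgesLt G))

-- Number each list L(u) of a 3-fold cover by F₃. For an edge ij of G, the edges of H between L(i) and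
-- L(j) form a partial matching of F₃, and every partial matching of F₃ lies on a line a + β b + c = 0
-- with β = ±1. A point x ∈ F₃ⁿ at which no x_i + β_ij x_j + c_ij vanishes picks from each L(u) its
-- x_u-th vertex, and these vertices are independent in H. Such a point exists by the combinatorial
-- Nullstellensatz: summing ∏ (x_i + β_ij x_j + c_ij) against the dual weights ∏_u w_{t_u}(x_u) over
-- F₃ⁿ gives the coefficient of x^t in ∏ (x_i + β_ij x_j), which is nonzero by hypothesis.

module Submission where

open import Defs renaming (sym to E-sym)
open import Data.Nat using (ℕ)
open import Data.Bool using (Bool)
open import Data.Fin using (Fin; toℕ)
open import Data.Vec using (Vec; map)
open import Data.Product using (∃)
open import Relation.Binary.PropositionalEquality using (_≢_)

open import Data.Bool using (true; false; T; not; _∧_; _∨_; if_then_else_)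
open import Data.Bool.Properties using (T-∧; T-≡; ¬-not)
open import Data.Empty using (⊥-elim)
open import Data.Fin using (zero; suc; combine; remQuot)
open import Data.Fin.Properties using (_≟_; remQuot-combine; suc-injective; toℕ-injective)
open import Data.Fin.Subset using (Subset; _∈_; _∉_; ∣_∣; ⁅_⁆; _∪_; outside; inside) renaming (⊥ to ∅)
open import Data.Fin.Subset.Properties using (∣⊥∣≡0; ∉⊥; x∈p∪q⁻; x∈⁅y⁆⇒x≡y; ∪-identityˡ)
open import Data.List as List using (List; []; _∷_; _++_; length; concatMap; cartesianProduct; findᵇ)
open import Data.List.Membership.Propositional using () renaming (_∈_ to _∈ₗ_)
open import Data.List.Membership.Propositional.Properties using (∈-concat⁺′; ∈-map⁺; ∈-allFin)
open import Data.List.Relation.Unary.Any using (here; there)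
open import Data.Maybe using (fromMaybe)
open import Data.Nat using (zero; suc; _+_; _≤_; _<_; _<ᵇ_; s≤s)
import Data.Nat.Properties as ℕₚ
open import Algebra.Properties.CommutativeSemigroup ℕₚ.+-commutativeSemigroup using (interchange)
open import Data.Product using (Σ; _×_; _,_; proj₁; proj₂; uncurry)
open import Data.Sum using (inj₁; inj₂)
open import Data.Unit using (tt)
open import Data.Vec using ([]; _∷_; zipWith; replicate; tabulate; lookup; sum)
  renaming (here to hereᵥ; there to thereᵥ)
open import Data.Vec.N-ary using (N-ary; Eq)
import Data.Vec.Properties as Vecₚ
open import Function using (_∘_; Injective)
open import Function.Bundles using (Equivalence)
open import Relation.Binary.Definitions using (tri<; tri≈; tri>)
open import Relation.Binary.PropositionalEquality
  using (_≡_; refl; sym; trans; cong; cong₂; subst; module ≡-Reasoning)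
open import Relation.Nullary using (does; yes; no)
open import Relation.Nullary.Decidable using (⌊_⌋; toWitness; fromWitness)

open ≡-Reasoning

all₃ : (F3 → Bool) → Bool
all₃ f = f 0₃ ∧ (f 1₃ ∧ f -1₃)

all₃-elim : ∀ f a → T (all₃ f) → T (f a)
all₃-elim f zero h = proj₁ (Equivalence.to (T-∧ {f 0₃}) h)
all₃-elim f (suc zero) h = proj₁ (Equivalence.to (T-∧ {f 1₃}) (proj₂ (Equivalence.to (T-∧ {f 0₃}) h)))
all₃-elim f (suc (suc zero)) h = proj₂ (Equivalence.to (T-∧ {f 1₃}) (proj₂ (Equivalence.to (T-∧ {f 0₃}) h)))

all₃-intro : ∀ f → (∀ a → T (f a)) → T (all₃ f)
all₃-intro f h = Equivalence.from T-∧ (h 0₃ , Equivalence.from T-∧ (h 1₃ , h -1₃))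

identityᵇ : ∀ k → N-ary k F3 F3 → N-ary k F3 F3 → Bool
identityᵇ zero l r = ⌊ l ≟ r ⌋
identityᵇ (suc k) l r = all₃ λ a → identityᵇ k (l a) (r a)

byEvaluation : ∀ k {l r : N-ary k F3 F3} → T (identityᵇ k l r) → Eq k _≡_ l r
byEvaluation zero h = toWitness h
byEvaluation (suc k) {l} {r} h a = byEvaluation k (all₃-elim (λ a → identityᵇ k (l a) (r a)) a h)

+-identityˡ₃ : ∀ a → (0₃ +₃ a) ≡ a
+-identityˡ₃ = byEvaluation 1 _

+-identityʳ₃ : ∀ a → (a +₃ 0₃) ≡ a
+-identityʳ₃ = byEvaluation 1 _

+-assoc₃ : ∀ a b c → ((a +₃ b) +₃ c) ≡ (a +₃ (b +₃ c))
+-assoc₃ = byEvaluation 3 _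

+-interchange₃ : ∀ a b c d e f →
  ((a +₃ b) +₃ ((c +₃ d) +₃ (e +₃ f))) ≡ ((a +₃ (c +₃ e)) +₃ (b +₃ (d +₃ f)))
+-interchange₃ = byEvaluation 6 _

*-identityˡ₃ : ∀ a → (1₃ *₃ a) ≡ a
*-identityˡ₃ = byEvaluation 1 _

*-identityʳ₃ : ∀ a → (a *₃ 1₃) ≡ a
*-identityʳ₃ = byEvaluation 1 _

*-zeroʳ₃ : ∀ a → (a *₃ 0₃) ≡ 0₃
*-zeroʳ₃ = byEvaluation 1 _

*-assoc₃ : ∀ a b c → ((a *₃ b) *₃ c) ≡ (a *₃ (b *₃ c))
*-assoc₃ = byEvaluation 3 _

*-interchange₃ : ∀ a b c d → ((a *₃ b) *₃ (c *₃ d)) ≡ ((a *₃ c) *₃ (b *₃ d))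
*-interchange₃ = byEvaluation 4 _

*-distribˡ-+₃ : ∀ a b c d → ((a *₃ b) +₃ ((a *₃ c) +₃ (a *₃ d))) ≡ (a *₃ (b +₃ (c +₃ d)))
*-distribˡ-+₃ = byEvaluation 4 _

*-distribʳ-+₃ : ∀ a b c d → ((b *₃ a) +₃ ((c *₃ a) +₃ (d *₃ a))) ≡ ((b +₃ (c +₃ d)) *₃ a)
*-distribʳ-+₃ = byEvaluation 4 _

Σ₃ : (F3 → F3) → F3
Σ₃ f = f 0₃ +₃ (f 1₃ +₃ f -1₃)

Σ₃-cong : ∀ {f g} → (∀ a → f a ≡ g a) → Σ₃ f ≡ Σ₃ g
Σ₃-cong f≗g = cong₂ _+₃_ (f≗g 0₃) (cong₂ _+₃_ (f≗g 1₃) (f≗g -1₃))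

Σ₃-+ : ∀ f g → Σ₃ (λ a → f a +₃ g a) ≡ (Σ₃ f +₃ Σ₃ g)
Σ₃-+ f g = +-interchange₃ (f 0₃) (g 0₃) (f 1₃) (g 1₃) (f -1₃) (g -1₃)

Σ₃-*ˡ : ∀ c f → Σ₃ (λ a → c *₃ f a) ≡ (c *₃ Σ₃ f)
Σ₃-*ˡ c f = *-distribˡ-+₃ c (f 0₃) (f 1₃) (f -1₃)

Σ₃-*ʳ : ∀ c f → Σ₃ (λ a → f a *₃ c) ≡ (Σ₃ f *₃ c)
Σ₃-*ʳ c f = *-distribʳ-+₃ c (f 0₃) (f 1₃) (f -1₃)

Σ₃-nonzero : ∀ f → Σ₃ f ≢ 0₃ → ∃ λ a → f a ≢ 0₃
Σ₃-nonzero f Σf≢0 with f 0₃ ≟ 0₃ | f 1₃ ≟ 0₃ | f -1₃ ≟ 0₃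
... | no f₀≢0 | _        | _        = 0₃ , f₀≢0
... | yes _   | no f₁≢0  | _        = 1₃ , f₁≢0
... | yes _   | yes _    | no f₂≢0  = -1₃ , f₂≢0
... | yes f₀≡0 | yes f₁≡0 | yes f₂≡0 =
  ⊥-elim (Σf≢0 (cong₂ _+₃_ f₀≡0 (cong₂ _+₃_ f₁≡0 f₂≡0)))

Σⁿ : ∀ n → (Vec F3 n → F3) → F3
Σⁿ zero f = f []
Σⁿ (suc n) f = Σ₃ λ a → Σⁿ n (λ x → f (a ∷ x))

Σⁿ-cong : ∀ n {f g} → (∀ x → f x ≡ g x) → Σⁿ n f ≡ Σⁿ n g
Σⁿ-cong zero f≗g = f≗g []
Σⁿ-cong (suc n) f≗g = Σ₃-cong λ a → Σⁿ-cong n λ x → f≗g (a ∷ x)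

Σⁿ-+ : ∀ n f g → Σⁿ n (λ x → f x +₃ g x) ≡ (Σⁿ n f +₃ Σⁿ n g)
Σⁿ-+ zero f g = refl
Σⁿ-+ (suc n) f g =
  trans (Σ₃-cong λ a → Σⁿ-+ n (f ∘ (a ∷_)) (g ∘ (a ∷_)))
        (Σ₃-+ (λ a → Σⁿ n (f ∘ (a ∷_))) (λ a → Σⁿ n (g ∘ (a ∷_))))

Σⁿ-*ˡ : ∀ n c f → Σⁿ n (λ x → c *₃ f x) ≡ (c *₃ Σⁿ n f)
Σⁿ-*ˡ zero c f = refl
Σⁿ-*ˡ (suc n) c f =
  trans (Σ₃-cong λ a → Σⁿ-*ˡ n c (f ∘ (a ∷_))) (Σ₃-*ˡ c λ a → Σⁿ n (f ∘ (a ∷_)))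

Σⁿ-nonzero : ∀ n f → Σⁿ n f ≢ 0₃ → ∃ λ x → f x ≢ 0₃
Σⁿ-nonzero zero f Σf≢0 = [] , Σf≢0
Σⁿ-nonzero (suc n) f Σf≢0 =
  let a , Σfₐ≢0 = Σ₃-nonzero (λ a → Σⁿ n (f ∘ (a ∷_))) Σf≢0
      x , fₐₓ≢0 = Σⁿ-nonzero n (f ∘ (a ∷_)) Σfₐ≢0
  in a ∷ x , fₐₓ≢0

_⊕_ : ∀ {n} → Vec ℕ n → Vec ℕ n → Vec ℕ n
_⊕_ = zipWith _+_

⊕-assoc : ∀ {n} (s u e : Vec ℕ n) → ((s ⊕ u) ⊕ e) ≡ (s ⊕ (u ⊕ e))
⊕-assoc = Vecₚ.zipWith-assoc ℕₚ.+-assoc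

sum-⊕ : ∀ {n} (s e : Vec ℕ n) → sum (s ⊕ e) ≡ sum s + sum e
sum-⊕ [] [] = refl
sum-⊕ (s ∷ ss) (e ∷ es) =
  trans (cong ((s + e) +_) (sum-⊕ ss es)) (interchange s e (sum ss) (sum es))

sum-replicate-0 : ∀ n → sum (replicate n 0) ≡ 0
sum-replicate-0 zero = refl
sum-replicate-0 (suc n) = sum-replicate-0 n

unit-zero : ∀ {n} → unit {suc n} zero ≡ 1 ∷ replicate n 0
unit-zero = cong (1 ∷_) (trans (Vecₚ.tabulate-allFin _) (Vecₚ.map-const _ 0))

sum-unit : ∀ {n} (i : Fin n) → sum (unit i) ≡ 1
sum-unit {suc n} zero = trans (cong sum (unit-zero {n})) (cong suc (sum-replicate-0 n))
sum-unit (suc i) = sum-unit i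

sum-⊕-unit : ∀ {n} (s : Vec ℕ n) k → sum (s ⊕ unit k) ≡ sum s + 1
sum-⊕-unit s k = trans (sum-⊕ s (unit k)) (cong (sum s +_) (sum-unit k))

_^₃_ : F3 → ℕ → F3
a ^₃ zero = 1₃
a ^₃ suc k = a *₃ (a ^₃ k)

^₃-+ : ∀ a m k → (a ^₃ (m + k)) ≡ ((a ^₃ m) *₃ (a ^₃ k))
^₃-+ a zero k = sym (*-identityˡ₃ (a ^₃ k))
^₃-+ a (suc m) k = trans (cong (a *₃_) (^₃-+ a m k)) (sym (*-assoc₃ a (a ^₃ m) (a ^₃ k)))

monomial : ∀ {n} → Vec ℕ n → Vec F3 n → F3
monomial [] [] = 1₃
monomial (e ∷ es) (a ∷ x) = (a ^₃ e) *₃ monomial es x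

monomial-⊕ : ∀ {n} (s e : Vec ℕ n) x → monomial (s ⊕ e) x ≡ (monomial s x *₃ monomial e x)
monomial-⊕ [] [] [] = refl
monomial-⊕ (s ∷ ss) (e ∷ es) (a ∷ x) = begin
  (a ^₃ (s + e)) *₃ monomial (ss ⊕ es) x
    ≡⟨ cong₂ _*₃_ (^₃-+ a s e) (monomial-⊕ ss es x) ⟩
  ((a ^₃ s) *₃ (a ^₃ e)) *₃ (monomial ss x *₃ monomial es x)
    ≡⟨ *-interchange₃ (a ^₃ s) (a ^₃ e) (monomial ss x) (monomial es x) ⟩
  ((a ^₃ s) *₃ monomial ss x) *₃ ((a ^₃ e) *₃ monomial es x) ∎

monomial-replicate-0 : ∀ {n} (x : Vec F3 n) → monomial (replicate n 0) x ≡ 1₃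
monomial-replicate-0 [] = refl
monomial-replicate-0 (a ∷ x) = cong (1₃ *₃_) (monomial-replicate-0 x)

monomial-unit : ∀ {n} (i : Fin n) x → monomial (unit i) x ≡ lookup x i
monomial-unit {suc n} zero (a ∷ x) = begin
  monomial (unit zero) (a ∷ x)          ≡⟨ cong (λ e → monomial e (a ∷ x)) (unit-zero {n}) ⟩
  (a *₃ 1₃) *₃ monomial (replicate _ 0) x ≡⟨ cong₂ _*₃_ (*-identityʳ₃ a) (monomial-replicate-0 x) ⟩
  a *₃ 1₃                                ≡⟨ *-identityʳ₃ a ⟩
  a                                      ∎
monomial-unit (suc i) (a ∷ x) = trans (*-identityˡ₃ _) (monomial-unit i x)

-- Dual weights

weight : F3 → F3 → F3
weight zero zero = 1₃
weight zero (suc _) = 0₃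
weight (suc zero) zero = -1₃
weight (suc zero) (suc zero) = 1₃
weight (suc zero) (suc (suc _)) = 0₃
weight (suc (suc _)) _ = -1₃

moment : F3 → ℕ → F3
moment t e = Σ₃ λ a → (a ^₃ e) *₃ weight t a

moment-diag : ∀ t → moment t (toℕ t) ≡ 1₃
moment-diag zero = refl
moment-diag (suc zero) = refl
moment-diag (suc (suc zero)) = refl

moment-below : ∀ t e → e < toℕ t → moment t e ≡ 0₃
moment-below (suc zero) zero _ = refl
moment-below (suc (suc zero)) zero _ = refl
moment-below (suc (suc zero)) (suc zero) _ = refl
moment-below (suc (suc zero)) (suc (suc e)) (s≤s (s≤s ()))
moment-below (suc zero) (suc e) (s≤s ())

Weight : ∀ {n} → Vec F3 n → Vec F3 n → F3
Weight [] [] = 1₃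
Weight (t ∷ ts) (a ∷ x) = weight t a *₃ Weight ts x

moments : ∀ {n} → Vec ℕ n → Vec F3 n → F3
moments [] [] = 1₃
moments (e ∷ es) (t ∷ ts) = moment t e *₃ moments es ts

Σⁿ-monomial-Weight : ∀ n (s : Vec ℕ n) t → Σⁿ n (λ x → monomial s x *₃ Weight t x) ≡ moments s t
Σⁿ-monomial-Weight zero [] [] = refl
Σⁿ-monomial-Weight (suc n) (s ∷ ss) (t ∷ ts) = begin
  Σ₃ (λ a → Σⁿ n (λ x → ((a ^₃ s) *₃ monomial ss x) *₃ (weight t a *₃ Weight ts x)))
    ≡⟨ Σ₃-cong (λ a → Σⁿ-cong n λ x → *-interchange₃ (a ^₃ s) (monomial ss x) (weight t a) (Weight ts x)) ⟩
  Σ₃ (λ a → Σⁿ n (λ x → ((a ^₃ s) *₃ weight t a) *₃ (monomial ss x *₃ Weight ts x)))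
    ≡⟨ Σ₃-cong (λ a → Σⁿ-*ˡ n ((a ^₃ s) *₃ weight t a) (λ x → monomial ss x *₃ Weight ts x)) ⟩
  Σ₃ (λ a → ((a ^₃ s) *₃ weight t a) *₃ Σⁿ n (λ x → monomial ss x *₃ Weight ts x))
    ≡⟨ Σ₃-cong (λ a → cong (((a ^₃ s) *₃ weight t a) *₃_) (Σⁿ-monomial-Weight n ss ts)) ⟩
  Σ₃ (λ a → ((a ^₃ s) *₃ weight t a) *₃ moments ss ts)
    ≡⟨ Σ₃-*ʳ (moments ss ts) (λ a → (a ^₃ s) *₃ weight t a) ⟩
  moment t s *₃ moments ss ts ∎

δ : ∀ {n} → Vec ℕ n → Vec ℕ n → F3
δ e t = if does (Vecₚ.≡-dec ℕₚ._≟_ e t) then 1₃ else 0₃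

δ-≢ : ∀ {n} (e t : Vec ℕ n) → e ≢ t → δ e t ≡ 0₃
δ-≢ e t e≢t with Vecₚ.≡-dec ℕₚ._≟_ e t
... | yes e≡t = ⊥-elim (e≢t e≡t)
... | no _ = refl

moments-diag : ∀ {n} (t : Vec F3 n) → moments (map toℕ t) t ≡ 1₃
moments-diag [] = refl
moments-diag (t ∷ ts) = cong₂ _*₃_ (moment-diag t) (moments-diag ts)

moments-off : ∀ {n} (s : Vec ℕ n) t → sum s ≤ sum (map toℕ t) → s ≢ map toℕ t → moments s t ≡ 0₃
moments-off [] [] _ s≢t = ⊥-elim (s≢t refl)
moments-off (s ∷ ss) (t ∷ ts) ≤t s≢t with ℕₚ.<-cmp s (toℕ t)
... | tri< s<t _ _ = cong (_*₃ moments ss ts) (moment-below t s s<t)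
... | tri≈ _ refl _ = trans (cong (moment t s *₃_) (moments-off ss ts ≤ts (s≢t ∘ cong (s ∷_))))
                            (*-zeroʳ₃ (moment t s))
  where ≤ts = ℕₚ.+-cancelˡ-≤ s (sum ss) (sum (map toℕ ts)) ≤t
... | tri> _ _ s>t = trans (cong (moment t s *₃_) (moments-off ss ts (ℕₚ.<⇒≤ <ts) (ℕₚ.<⇒≢ <ts ∘ cong sum)))
                           (*-zeroʳ₃ (moment t s))
  where <ts = ℕₚ.+-cancelˡ-< (toℕ t) (sum ss) (sum (map toℕ ts))
                (ℕₚ.<-≤-trans (ℕₚ.+-monoˡ-< (sum ss) s>t) ≤t)

moments≡δ : ∀ {n} (s : Vec ℕ n) t → sum s ≤ sum (map toℕ t) → moments s t ≡ δ s (map toℕ t)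
moments≡δ s t ≤t with Vecₚ.≡-dec ℕₚ._≟_ s (map toℕ t)
... | yes refl = moments-diag t
... | no s≢t = moments-off s t ≤t s≢t

linearExt : ∀ {n} → (Vec ℕ n → F3) → Poly n → F3
linearExt g [] = 0₃
linearExt g ((e , c) ∷ p) = (c *₃ g e) +₃ linearExt g p

linearExt-cong : ∀ {n} {g h : Vec ℕ n → F3} p → (∀ e → g e ≡ h e) → linearExt g p ≡ linearExt h p
linearExt-cong [] g≗h = refl
linearExt-cong ((e , c) ∷ p) g≗h = cong₂ _+₃_ (cong (c *₃_) (g≗h e)) (linearExt-cong p g≗h)

coeff≡linearExt-δ : ∀ {n} (p : Poly n) t → coeff p t ≡ linearExt (λ e → δ e t) p
coeff≡linearExt-δ [] t = refl
coeff≡linearExt-δ ((e , c) ∷ p) t with does (Vecₚ.≡-dec ℕₚ._≟_ e t)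
... | true = cong₂ _+₃_ (sym (*-identityʳ₃ c)) (coeff≡linearExt-δ p t)
... | false = begin
  coeff p t                                 ≡⟨ coeff≡linearExt-δ p t ⟩
  linearExt (λ e → δ e t) p                 ≡⟨ +-identityˡ₃ _ ⟨
  0₃ +₃ linearExt (λ e → δ e t) p           ≡⟨ cong (_+₃ linearExt (λ e → δ e t) p) (*-zeroʳ₃ c) ⟨
  (c *₃ 0₃) +₃ linearExt (λ e → δ e t) p    ∎

linearExt-++ : ∀ {n} g (p q : Poly n) → linearExt g (p ++ q) ≡ (linearExt g p +₃ linearExt g q)
linearExt-++ g [] q = sym (+-identityˡ₃ (linearExt g q))
linearExt-++ g ((e , c) ∷ p) q =
  trans (cong ((c *₃ g e) +₃_) (linearExt-++ g p q)) (sym (+-assoc₃ (c *₃ g e) _ _))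

linearExt-scale : ∀ {n} g (e : Vec ℕ n) c q →
  linearExt g (List.map (λ (e′ , c′) → (e ⊕ e′ , c *₃ c′)) q) ≡ (c *₃ linearExt (λ e′ → g (e ⊕ e′)) q)
linearExt-scale g e c [] = sym (*-zeroʳ₃ c)
linearExt-scale g e c ((e′ , c′) ∷ q) = begin
  ((c *₃ c′) *₃ g (e ⊕ e′)) +₃ linearExt g (List.map (λ (e′ , c′) → (e ⊕ e′ , c *₃ c′)) q)
    ≡⟨ cong₂ _+₃_ (*-assoc₃ c c′ (g (e ⊕ e′))) (linearExt-scale g e c q) ⟩
  (c *₃ (c′ *₃ g (e ⊕ e′))) +₃ (c *₃ linearExt (λ e′ → g (e ⊕ e′)) q)
    ≡⟨ distrib c (c′ *₃ g (e ⊕ e′)) (linearExt (λ e′ → g (e ⊕ e′)) q) ⟩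
  c *₃ ((c′ *₃ g (e ⊕ e′)) +₃ linearExt (λ e′ → g (e ⊕ e′)) q) ∎
  where
  distrib : ∀ a b d → ((a *₃ b) +₃ (a *₃ d)) ≡ (a *₃ (b +₃ d))
  distrib = byEvaluation 3 _

linearExt-*P : ∀ {n} g (p q : Poly n) →
  linearExt g (p *P q) ≡ linearExt (λ e → linearExt (λ e′ → g (e ⊕ e′)) q) p
linearExt-*P g [] q = refl
linearExt-*P g ((e , c) ∷ p) q =
  trans (linearExt-++ g (List.map (λ (e′ , c′) → (e ⊕ e′ , c *₃ c′)) q) (p *P q))
        (cong₂ _+₃_ (linearExt-scale g e c q) (linearExt-*P g p q))

linearExt-linForm*P : ∀ {n} g (i : Fin n) β j q →
  linearExt g (linForm i β j *P q) ≡
    (linearExt (λ e → g (unit i ⊕ e)) q +₃ (β *₃ linearExt (λ e → g (unit j ⊕ e)) q))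
linearExt-linForm*P g i β j q =
  trans (linearExt-*P g (linForm i β j) q)
        (simplify (linearExt (λ e → g (unit i ⊕ e)) q) β (linearExt (λ e → g (unit j ⊕ e)) q))
  where
  simplify : ∀ a b d → ((1₃ *₃ a) +₃ ((b *₃ d) +₃ 0₃)) ≡ (a +₃ (b *₃ d))
  simplify = byEvaluation 3 _

linearProduct : ∀ {n} → (Fin n → Fin n → F3) → List (Fin n × Fin n) → Poly n
linearProduct β es = prodP (List.map (λ (i , j) → linForm i (β i j) j) es)

linearProduct-homogeneous : ∀ {n} β (es : List (Fin n × Fin n)) g →
  (∀ e → sum e ≡ length es → g e ≡ 0₃) → linearExt g (linearProduct β es) ≡ 0₃
linearProduct-homogeneous {n} β [] g vanish =
  cong (λ z → (1₃ *₃ z) +₃ 0₃) (vanish (replicate n 0) (sum-replicate-0 n))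
linearProduct-homogeneous β ((i , j) ∷ es) g vanish = begin
  linearExt g (linearProduct β ((i , j) ∷ es))
    ≡⟨ linearExt-linForm*P g i (β i j) j (linearProduct β es) ⟩
  linearExt (λ e → g (unit i ⊕ e)) (linearProduct β es)
    +₃ (β i j *₃ linearExt (λ e → g (unit j ⊕ e)) (linearProduct β es))
    ≡⟨ cong₂ (λ a b → a +₃ (β i j *₃ b)) (linearProduct-homogeneous β es _ (shifted i))
                                         (linearProduct-homogeneous β es _ (shifted j)) ⟩
  0₃ +₃ (β i j *₃ 0₃)
    ≡⟨ cong (0₃ +₃_) (*-zeroʳ₃ (β i j)) ⟩
  0₃ ∎
  where
  shifted : ∀ k e → sum e ≡ length es → g (unit k ⊕ e) ≡ 0₃
  shifted k e deg = vanish (unit k ⊕ e) (trans (sum-⊕ (unit k) e) (cong₂ _+_ (sum-unit k) deg))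

-- A combinatorial Nullstellensatz for products of affine forms over F₃

∏₃ : List F3 → F3
∏₃ = List.foldr _*₃_ 1₃

∏₃-nonzero : ∀ {xs a} → ∏₃ xs ≢ 0₃ → a ∈ₗ xs → a ≢ 0₃
∏₃-nonzero {a ∷ xs} ∏≢0 (here refl) a≡0 = ∏≢0 (cong (_*₃ ∏₃ xs) a≡0)
∏₃-nonzero {x ∷ xs} ∏≢0 (there a∈xs) =
  ∏₃-nonzero (λ ∏xs≡0 → ∏≢0 (trans (cong (x *₃_) ∏xs≡0) (*-zeroʳ₃ x))) a∈xs

affine : ∀ {n} (β c : Fin n → Fin n → F3) → Fin n × Fin n → Vec F3 n → F3
affine β c (i , j) x = (lookup x i +₃ (β i j *₃ lookup x j)) +₃ c i j

affineProduct : ∀ {n} (β c : Fin n → Fin n → F3) → List (Fin n × Fin n) → Vec F3 n → F3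
affineProduct β c es x = ∏₃ (List.map (λ p → affine β c p x) es)

module _ {n} (β c : Fin n → Fin n → F3) (t : Vec F3 n) where

  private
    τ : Vec ℕ n
    τ = map toℕ t

  integrand : Vec ℕ n → List (Fin n × Fin n) → Vec F3 n → F3
  integrand s es x = (monomial s x *₃ affineProduct β c es x) *₃ Weight t x

  integrand-∷ : ∀ s i j es x → integrand s ((i , j) ∷ es) x ≡
    (integrand (s ⊕ unit i) es x +₃ ((β i j *₃ integrand (s ⊕ unit j) es x) +₃ (c i j *₃ integrand s es x)))
  integrand-∷ s i j es x = begin
    (m *₃ (((lookup x i +₃ (β i j *₃ lookup x j)) +₃ c i j) *₃ P)) *₃ W
      ≡⟨ expand m (lookup x i) (lookup x j) (β i j) (c i j) P W ⟩
    (((m *₃ lookup x i) *₃ P) *₃ W) +₃ ((β i j *₃ (((m *₃ lookup x j) *₃ P) *₃ W)) +₃ (c i j *₃ ((m *₃ P) *₃ W)))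
      ≡⟨ cong₂ (λ mᵢ mⱼ → (((mᵢ *₃ P) *₃ W) +₃ ((β i j *₃ ((mⱼ *₃ P) *₃ W)) +₃ (c i j *₃ ((m *₃ P) *₃ W)))))
               (sym (monomial-⊕-unit i)) (sym (monomial-⊕-unit j)) ⟩
    integrand (s ⊕ unit i) es x +₃ ((β i j *₃ integrand (s ⊕ unit j) es x) +₃ (c i j *₃ integrand s es x)) ∎
    where
    m = monomial s x
    P = affineProduct β c es x
    W = Weight t x
    monomial-⊕-unit : ∀ k → monomial (s ⊕ unit k) x ≡ (m *₃ lookup x k)
    monomial-⊕-unit k = trans (monomial-⊕ s (unit k) x) (cong (m *₃_) (monomial-unit k x))
    expand : ∀ m a b β c P W →
      ((m *₃ (((a +₃ (β *₃ b)) +₃ c) *₃ P)) *₃ W) ≡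
        ((((m *₃ a) *₃ P) *₃ W) +₃ ((β *₃ (((m *₃ b) *₃ P) *₃ W)) +₃ (c *₃ ((m *₃ P) *₃ W))))
    expand = byEvaluation 7 _

  Σⁿ-integrand-∷ : ∀ s i j es → Σⁿ n (integrand s ((i , j) ∷ es)) ≡
    (Σⁿ n (integrand (s ⊕ unit i) es)
      +₃ ((β i j *₃ Σⁿ n (integrand (s ⊕ unit j) es)) +₃ (c i j *₃ Σⁿ n (integrand s es))))
  Σⁿ-integrand-∷ s i j es = begin
    Σⁿ n (integrand s ((i , j) ∷ es))
      ≡⟨ Σⁿ-cong n (integrand-∷ s i j es) ⟩
    Σⁿ n (λ x → Iᵢ x +₃ ((β i j *₃ Iⱼ x) +₃ (c i j *₃ I x)))
      ≡⟨ Σⁿ-+ n Iᵢ _ ⟩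
    Σⁿ n Iᵢ +₃ Σⁿ n (λ x → (β i j *₃ Iⱼ x) +₃ (c i j *₃ I x))
      ≡⟨ cong (Σⁿ n Iᵢ +₃_) (Σⁿ-+ n (λ x → β i j *₃ Iⱼ x) (λ x → c i j *₃ I x)) ⟩
    Σⁿ n Iᵢ +₃ (Σⁿ n (λ x → β i j *₃ Iⱼ x) +₃ Σⁿ n (λ x → c i j *₃ I x))
      ≡⟨ cong (Σⁿ n Iᵢ +₃_) (cong₂ _+₃_ (Σⁿ-*ˡ n (β i j) Iⱼ) (Σⁿ-*ˡ n (c i j) I)) ⟩
    Σⁿ n Iᵢ +₃ ((β i j *₃ Σⁿ n Iⱼ) +₃ (c i j *₃ Σⁿ n I)) ∎
    where
    I = integrand s es
    Iᵢ = integrand (s ⊕ unit i) es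
    Iⱼ = integrand (s ⊕ unit j) es

  Σⁿ-integrand-[] : ∀ s → sum s ≤ sum τ → Σⁿ n (integrand s []) ≡ linearExt (λ e → δ (s ⊕ e) τ) onePoly
  Σⁿ-integrand-[] s ≤τ = begin
    Σⁿ n (integrand s [])
      ≡⟨ Σⁿ-cong n (λ x → cong (_*₃ Weight t x) (*-identityʳ₃ (monomial s x))) ⟩
    Σⁿ n (λ x → monomial s x *₃ Weight t x)
      ≡⟨ Σⁿ-monomial-Weight n s t ⟩
    moments s t
      ≡⟨ moments≡δ s t ≤τ ⟩
    δ s τ
      ≡⟨ cong (λ e → δ e τ) (Vecₚ.zipWith-identityʳ ℕₚ.+-identityʳ s) ⟨
    δ (s ⊕ replicate n 0) τ
      ≡⟨ trans (*-identityˡ₃ _) (+-identityʳ₃ _) ⟨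
    (1₃ *₃ δ (s ⊕ replicate n 0) τ) +₃ 0₃ ∎

  -- Only the top-degree part of the affine product survives the weighted sum, and that part is the
  -- product of the linear forms.
  Σⁿ-integrand : ∀ es s → sum s + length es ≤ sum τ →
    Σⁿ n (integrand s es) ≡ linearExt (λ e → δ (s ⊕ e) τ) (linearProduct β es)

  Σⁿ-integrand-low : ∀ es s → sum s + length es < sum τ → Σⁿ n (integrand s es) ≡ 0₃
  Σⁿ-integrand-low es s <τ =
    trans (Σⁿ-integrand es s (ℕₚ.<⇒≤ <τ))
          (linearProduct-homogeneous β es _ λ e deg → δ-≢ (s ⊕ e) τ λ s⊕e≡τ →
            ℕₚ.<⇒≢ <τ (trans (cong (sum s +_) (sym deg)) (trans (sym (sum-⊕ s e)) (cong sum s⊕e≡τ))))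

  Σⁿ-integrand [] s ≤τ = Σⁿ-integrand-[] s (ℕₚ.≤-trans (ℕₚ.m≤m+n (sum s) 0) ≤τ)
  Σⁿ-integrand ((i , j) ∷ es) s ≤τ = begin
    Σⁿ n (integrand s ((i , j) ∷ es))
      ≡⟨ Σⁿ-integrand-∷ s i j es ⟩
    Σⁿ n (integrand (s ⊕ unit i) es)
      +₃ ((β i j *₃ Σⁿ n (integrand (s ⊕ unit j) es)) +₃ (c i j *₃ Σⁿ n (integrand s es)))
      ≡⟨ cong₂ (λ a b → a +₃ ((β i j *₃ b) +₃ (c i j *₃ Σⁿ n (integrand s es)))) (shifted i) (shifted j) ⟩
    Lᵢ +₃ ((β i j *₃ Lⱼ) +₃ (c i j *₃ Σⁿ n (integrand s es)))
      ≡⟨ cong (λ z → Lᵢ +₃ ((β i j *₃ Lⱼ) +₃ (c i j *₃ z))) low ⟩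
    Lᵢ +₃ ((β i j *₃ Lⱼ) +₃ (c i j *₃ 0₃))
      ≡⟨ cong (Lᵢ +₃_) (trans (cong ((β i j *₃ Lⱼ) +₃_) (*-zeroʳ₃ (c i j))) (+-identityʳ₃ (β i j *₃ Lⱼ))) ⟩
    Lᵢ +₃ (β i j *₃ Lⱼ)
      ≡⟨ linearExt-linForm*P (λ e → δ (s ⊕ e) τ) i (β i j) j (linearProduct β es) ⟨
    linearExt (λ e → δ (s ⊕ e) τ) (linearProduct β ((i , j) ∷ es)) ∎
    where
    shiftedExt : Fin n → F3
    shiftedExt k = linearExt (λ e → δ (s ⊕ (unit k ⊕ e)) τ) (linearProduct β es)
    Lᵢ = shiftedExt i
    Lⱼ = shiftedExt j
    shifted : ∀ k → Σⁿ n (integrand (s ⊕ unit k) es) ≡ shiftedExt k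
    shifted k = trans (Σⁿ-integrand es (s ⊕ unit k) (subst (_≤ sum τ) (sym degree) ≤τ))
                      (linearExt-cong (linearProduct β es) λ e → cong (λ e′ → δ e′ τ) (⊕-assoc s (unit k) e))
      where
      degree : sum (s ⊕ unit k) + length es ≡ sum s + suc (length es)
      degree = trans (cong (_+ length es) (sum-⊕-unit s k)) (ℕₚ.+-assoc (sum s) 1 (length es))
    low : Σⁿ n (integrand s es) ≡ 0₃
    low = Σⁿ-integrand-low es s (ℕₚ.<-≤-trans (ℕₚ.+-monoʳ-< (sum s) (ℕₚ.n<1+n (length es))) ≤τ)

  coeff-off-degree : ∀ es → length es ≢ sum τ → coeff (linearProduct β es) τ ≡ 0₃
  coeff-off-degree es ≢τ =
    trans (coeff≡linearExt-δ (linearProduct β es) τ)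
          (linearProduct-homogeneous β es _ λ e deg → δ-≢ e τ λ e≡τ → ≢τ (trans (sym deg) (cong sum e≡τ)))

  coeff≡Σⁿ-integrand : ∀ es → length es ≡ sum τ →
    coeff (linearProduct β es) τ ≡ Σⁿ n (integrand (replicate n 0) es)
  coeff≡Σⁿ-integrand es ≡τ = begin
    coeff (linearProduct β es) τ
      ≡⟨ coeff≡linearExt-δ (linearProduct β es) τ ⟩
    linearExt (λ e → δ e τ) (linearProduct β es)
      ≡⟨ linearExt-cong (linearProduct β es)
           (λ e → cong (λ e′ → δ e′ τ) (Vecₚ.zipWith-identityˡ ℕₚ.+-identityˡ e)) ⟨
    linearExt (λ e → δ (replicate n 0 ⊕ e) τ) (linearProduct β es)
      ≡⟨ Σⁿ-integrand es (replicate n 0) (ℕₚ.≤-reflexive (trans (cong (_+ length es) (sum-replicate-0 n)) ≡τ)) ⟨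
    Σⁿ n (integrand (replicate n 0) es) ∎

  affineProduct-nonvanishing : ∀ es → coeff (linearProduct β es) τ ≢ 0₃ → ∃ λ x → affineProduct β c es x ≢ 0₃
  affineProduct-nonvanishing es coeff≢0 with length es ℕₚ.≟ sum τ
  ... | no ≢τ = ⊥-elim (coeff≢0 (coeff-off-degree es ≢τ))
  ... | yes ≡τ =
    let x , integrand≢0 = Σⁿ-nonzero n (integrand (replicate n 0) es) (coeff≢0 ∘ trans (coeff≡Σⁿ-integrand es ≡τ))
    in x , λ P≡0 → integrand≢0 (trans (cong (λ P → (monomial (replicate n 0) x *₃ P) *₃ Weight t x) P≡0)
                                      (*-zero₃ (monomial (replicate n 0) x) (Weight t x)))
    where
    *-zero₃ : ∀ a b → ((a *₃ 0₃) *₃ b) ≡ 0₃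
    *-zero₃ = byEvaluation 2 _

-- Partial matchings of F₃ lie on lines

IsMatching : (F3 → F3 → Bool) → Set
IsMatching R = (∀ a b b′ → R a b ≡ true → R a b′ ≡ true → b ≡ b′)
             × (∀ a a′ b → R a b ≡ true → R a′ b ≡ true → a ≡ a′)

OnLine : Bool × F3 → (F3 → F3 → Bool) → Set
OnLine (β , c) R = ∀ a b → R a b ≡ true → ((a +₃ (sign β *₃ b)) +₃ c) ≡ 0₃

table : (F3 → F3 → Bool) → Vec Bool 9
table R = tabulate (uncurry R ∘ remQuot 3)

fromTable : Vec Bool 9 → F3 → F3 → Bool
fromTable v a b = lookup v (combine a b)

fromTable-table : ∀ R a b → fromTable (table R) a b ≡ R a b
fromTable-table R a b =
  trans (Vecₚ.lookup∘tabulate (uncurry R ∘ remQuot 3) (combine a b)) (cong (uncurry R) (remQuot-combine a b))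

matchingAtᵇ : (F3 → F3 → Bool) → F3 → F3 → F3 → Bool
matchingAtᵇ R a b b′ = (not (R a b ∧ R a b′) ∨ ⌊ b ≟ b′ ⌋) ∧ (not (R b a ∧ R b′ a) ∨ ⌊ b ≟ b′ ⌋)

matchingᵇ : (F3 → F3 → Bool) → Bool
matchingᵇ R = all₃ λ a → all₃ λ b → all₃ λ b′ → matchingAtᵇ R a b b′

onLineAtᵇ : Bool × F3 → (F3 → F3 → Bool) → F3 → F3 → Bool
onLineAtᵇ (β , c) R a b = not (R a b) ∨ ⌊ ((a +₃ (sign β *₃ b)) +₃ c) ≟ 0₃ ⌋

onLineᵇ : Bool × F3 → (F3 → F3 → Bool) → Bool
onLineᵇ l R = all₃ λ a → all₃ λ b → onLineAtᵇ l R a b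

lineOfTable : Vec Bool 9 → Bool × F3
lineOfTable v = fromMaybe (true , 0₃)
  (findᵇ (λ l → onLineᵇ l (fromTable v)) (cartesianProduct (true ∷ false ∷ []) (0₃ ∷ 1₃ ∷ -1₃ ∷ [])))

lineOf : (F3 → F3 → Bool) → Bool × F3
lineOf R = lineOfTable (table R)

allVec : ∀ k → (Vec Bool k → Bool) → Bool
allVec zero f = f []
allVec (suc k) f = allVec k (f ∘ (true ∷_)) ∧ allVec k (f ∘ (false ∷_))

allVec-elim : ∀ k f → T (allVec k f) → ∀ v → T (f v)
allVec-elim zero f h [] = h
allVec-elim (suc k) f h (true ∷ v) = allVec-elim k _ (proj₁ (Equivalence.to (T-∧ {allVec k (f ∘ (true ∷_))}) h)) v
allVec-elim (suc k) f h (false ∷ v) = allVec-elim k _ (proj₂ (Equivalence.to (T-∧ {allVec k (f ∘ (true ∷_))}) h)) v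

T-⇒ : ∀ {x z} → T (not x ∨ z) → T x → T z
T-⇒ {true} z _ = z

T-⇒-intro : ∀ x y z → (x ≡ true → y ≡ true → T z) → T (not (x ∧ y) ∨ z)
T-⇒-intro true true z h = h refl refl
T-⇒-intro true false z h = tt
T-⇒-intro false y z h = tt

matchingᵇ-complete : ∀ R → IsMatching R → T (matchingᵇ R)
matchingᵇ-complete R (functional , injective) =
  all₃-intro _ λ a → all₃-intro _ λ b → all₃-intro (matchingAtᵇ R a b) λ b′ → Equivalence.from T-∧
    ( T-⇒-intro (R a b) (R a b′) ⌊ b ≟ b′ ⌋ (λ r r′ → fromWitness (functional a b b′ r r′))
    , T-⇒-intro (R b a) (R b′ a) ⌊ b ≟ b′ ⌋ (λ r r′ → fromWitness (injective b b′ a r r′)))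

matchingᵇ⇒onLineᵇ : ∀ v → T (not (matchingᵇ (fromTable v)) ∨ onLineᵇ (lineOfTable v) (fromTable v))
matchingᵇ⇒onLineᵇ = allVec-elim 9 _ tt

matching⇒onLine : ∀ R → IsMatching R → OnLine (lineOf R) R
matching⇒onLine R (functional , injective) a b Rab =
  toWitness (T-⇒ onLineAt (Equivalence.from T-≡ (trans (R≗ a b) Rab)))
  where
  R≗ = fromTable-table R
  tabled-matching : IsMatching (fromTable (table R))
  tabled-matching =
      (λ a b b′ r r′ → functional a b b′ (trans (sym (R≗ a b)) r) (trans (sym (R≗ a b′)) r′))
    , (λ a a′ b r r′ → injective a a′ b (trans (sym (R≗ a b)) r) (trans (sym (R≗ a′ b)) r′))
  onLineᵇ-R : T (onLineᵇ (lineOf R) (fromTable (table R)))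
  onLineᵇ-R = T-⇒ (matchingᵇ⇒onLineᵇ (table R)) (matchingᵇ-complete _ tabled-matching)
  onLineAt : T (onLineAtᵇ (lineOf R) (fromTable (table R)) a b)
  onLineAt = all₃-elim (onLineAtᵇ (lineOf R) (fromTable (table R)) a) b
               (all₃-elim (λ a → all₃ (onLineAtᵇ (lineOf R) (fromTable (table R)) a)) a onLineᵇ-R)

enumerate : ∀ {M k} (p : Subset M) → ∣ p ∣ ≡ k →
  Σ (Fin k → Fin M) λ f → (∀ a → f a ∈ p) × Injective _≡_ _≡_ f
enumerate {k = zero} [] refl = (λ ()) , (λ ()) , λ {}
enumerate (outside ∷ p) ∣p∣≡k =
  let f , f∈p , f-injective = enumerate p ∣p∣≡k
  in suc ∘ f , thereᵥ ∘ f∈p , f-injective ∘ suc-injective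
enumerate {k = suc k} (inside ∷ p) ∣p∣≡k with enumerate p (ℕₚ.suc-injective ∣p∣≡k)
... | f , f∈p , f-injective = g , g∈p , g-injective
  where
  g : Fin (suc k) → Fin _
  g zero = zero
  g (suc a) = suc (f a)
  g∈p : ∀ a → g a ∈ (inside ∷ p)
  g∈p zero = hereᵥ
  g∈p (suc a) = thereᵥ (f∈p a)
  g-injective : Injective _≡_ _≡_ g
  g-injective {zero} {zero} _ = refl
  g-injective {suc a} {suc a′} ga≡ga′ = cong suc (f-injective (suc-injective ga≡ga′))

image : ∀ {k M} → (Fin k → Fin M) → Subset M
image {zero} f = ∅
image {suc k} f = ⁅ f zero ⁆ ∪ image (f ∘ suc)

∈-image⁻ : ∀ {k M} (f : Fin k → Fin M) {h} → h ∈ image f → ∃ λ a → f a ≡ h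
∈-image⁻ {zero} f h∈ = ⊥-elim (∉⊥ h∈)
∈-image⁻ {suc k} f h∈ with x∈p∪q⁻ ⁅ f zero ⁆ (image (f ∘ suc)) h∈
... | inj₁ h∈⁅f0⁆ = zero , sym (x∈⁅y⁆⇒x≡y (f zero) h∈⁅f0⁆)
... | inj₂ h∈image = let a , fa≡h = ∈-image⁻ (f ∘ suc) h∈image in suc a , fa≡h

∣⁅x⁆∪p∣ : ∀ {M} (x : Fin M) p → x ∉ p → ∣ ⁅ x ⁆ ∪ p ∣ ≡ suc ∣ p ∣
∣⁅x⁆∪p∣ zero (inside ∷ p) x∉p = ⊥-elim (x∉p hereᵥ)
∣⁅x⁆∪p∣ zero (outside ∷ p) x∉p = cong (suc ∘ ∣_∣) (∪-identityˡ p)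
∣⁅x⁆∪p∣ (suc x) (inside ∷ p) x∉p = cong suc (∣⁅x⁆∪p∣ x p (x∉p ∘ thereᵥ))
∣⁅x⁆∪p∣ (suc x) (outside ∷ p) x∉p = ∣⁅x⁆∪p∣ x p (x∉p ∘ thereᵥ)

∣image∣ : ∀ {k M} (f : Fin k → Fin M) → Injective _≡_ _≡_ f → ∣ image f ∣ ≡ k
∣image∣ {zero} {M} f _ = ∣⊥∣≡0 M
∣image∣ {suc k} f f-injective =
  trans (∣⁅x⁆∪p∣ (f zero) (image (f ∘ suc)) f0∉image)
        (cong suc (∣image∣ (f ∘ suc) (suc-injective ∘ f-injective)))
  where
  f0∉image : f zero ∉ image (f ∘ suc)
  f0∉image f0∈image with ∈-image⁻ (f ∘ suc) f0∈image
  ... | a , fa≡f0 with f-injective fa≡f0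
  ...   | ()

∈-edgesLt : ∀ {n} (G : SimpleGraph n) {i j} → E G i j ≡ true → toℕ i < toℕ j → (i , j) ∈ₗ edgesLt G
∈-edgesLt G {i} {j} Eij i<j = ∈-concatMap⁺ (∈-concatMap⁺ ij∈ (∈-allFin j)) (∈-allFin i)
  where
  ∈-concatMap⁺ : ∀ {A B : Set} {f : A → List B} {x y xs} → y ∈ₗ f x → x ∈ₗ xs → y ∈ₗ concatMap f xs
  ∈-concatMap⁺ {f = f} y∈fx x∈xs = ∈-concat⁺′ y∈fx (∈-map⁺ f x∈xs)
  ij∈ : (i , j) ∈ₗ (if E G i j ∧ (toℕ i <ᵇ toℕ j) then (i , j) ∷ [] else [])
  ij∈ rewrite Eij | Equivalence.to T-≡ (ℕₚ.<⇒<ᵇ i<j) = here refl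

module _ {n} {G : SimpleGraph n} (C : Cover G) (threeFold : IsFold C 3) where

  vertexAt : Fin n → F3 → Fin (N C)
  vertexAt u = proj₁ (enumerate (L C u) (threeFold u))

  vertexAt-∈ : ∀ u a → vertexAt u a ∈ L C u
  vertexAt-∈ u = proj₁ (proj₂ (enumerate (L C u) (threeFold u)))

  vertexAt-injective : ∀ u → Injective _≡_ _≡_ (vertexAt u)
  vertexAt-injective u = proj₂ (proj₂ (enumerate (L C u) (threeFold u)))

  adjacentAt : Fin n → Fin n → F3 → F3 → Bool
  adjacentAt i j a b = E (H C) (vertexAt i a) (vertexAt j b)

  adjacentAt-matching : ∀ {i j} → E G i j ≡ true → IsMatching (adjacentAt i j)
  adjacentAt-matching {i} {j} Eij =
      (λ a b b′ r r′ → vertexAt-injective j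
         (matching C i j Eij _ _ _ (vertexAt-∈ i a) (vertexAt-∈ j b) (vertexAt-∈ j b′) r r′))
    , (λ a a′ b r r′ → vertexAt-injective i
         (matching C j i (trans (E-sym G j i) Eij) _ _ _ (vertexAt-∈ j b) (vertexAt-∈ i a) (vertexAt-∈ i a′)
           (trans (E-sym (H C) _ _) r) (trans (E-sym (H C) _ _) r′)))

  edgeLine : Fin n → Fin n → Bool × F3
  edgeLine i j = lineOf (adjacentAt i j)

  edgeSign edgeShift : Fin n → Fin n → F3
  edgeSign i j = sign (proj₁ (edgeLine i j))
  edgeShift i j = proj₂ (edgeLine i j)

  colouring : (x : Vec F3 n) →
    (∀ {i j} → (i , j) ∈ₗ edgesLt G → affine edgeSign edgeShift (i , j) x ≢ 0₃) → HasColoring C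
  colouring x avoids = image colour , independent , ∣image∣ colour colour-injective
    where
    colour : Fin n → Fin (N C)
    colour u = vertexAt u (lookup x u)

    colour-injective : Injective _≡_ _≡_ colour
    colour-injective {u} {v} cu≡cv =
      part-disjoint C (colour u) u v (vertexAt-∈ u _) (subst (_∈ L C v) (sym cu≡cv) (vertexAt-∈ v _))

    conflict⇒edge : ∀ {u v} → E (H C) (colour u) (colour v) ≡ true → E G u v ≡ true
    conflict⇒edge {u} {v} conflict with edges-ok C u v _ _ (vertexAt-∈ u _) (vertexAt-∈ v _) conflict
    ... | inj₂ Euv = Euv
    ... | inj₁ refl with () ← trans (sym conflict) (irr (H C) (colour u))

    ordered-no-conflict : ∀ {i j} → toℕ i < toℕ j → E (H C) (colour i) (colour j) ≢ true
    ordered-no-conflict i<j conflict =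
      avoids (∈-edgesLt G (conflict⇒edge conflict) i<j)
             (matching⇒onLine _ (adjacentAt-matching (conflict⇒edge conflict)) _ _ conflict)

    no-conflict : ∀ u v → E (H C) (colour u) (colour v) ≢ true
    no-conflict u v conflict with ℕₚ.<-cmp (toℕ u) (toℕ v)
    ... | tri< u<v _ _ = ordered-no-conflict u<v conflict
    ... | tri> _ _ v<u = ordered-no-conflict v<u (trans (E-sym (H C) _ _) conflict)
    ... | tri≈ _ u≡v _ with refl ← toℕ-injective u≡v
                       with () ← trans (sym (conflict⇒edge conflict)) (irr G u)

    independent : ∀ h h′ → h ∈ image colour → h′ ∈ image colour → E (H C) h h′ ≡ false
    independent h h′ h∈ h′∈ with ∈-image⁻ colour h∈ | ∈-image⁻ colour h′∈
    ... | u , refl | v , refl = ¬-not (no-conflict u v)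

corollary1p5 : ∀ (n : ℕ) (G : SimpleGraph n) → χDP≥ G 2 →
    (∀ (b : Fin n → Fin n → Bool) →
      ∃ λ (t : Vec (Fin 3) n) → coeff (fPoly G b) (map toℕ t) ≢ 0₃) →
    χDP≤ G 3
corollary1p5 n G _ coefficient≢0 = 3 , ℕₚ.≤-refl , λ C threeFold →
  let t , coeff≢0 = coefficient≢0 λ i j → proj₁ (edgeLine C threeFold i j)
      x , product≢0 = affineProduct-nonvanishing (edgeSign C threeFold) (edgeShift C threeFold) t
                                                 (edgesLt G) coeff≢0
  in colouring C threeFold x λ ij∈E → ∏₃-nonzero product≢0 (∈-map⁺ _ ij∈E)
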